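{- Let $R$ be a $G$-rack. Then the following statements are equivalent: (1) $\mathcal{R}(R)$ is a Boolean algebra; (2) $\mathcal{R}(R)$ is modular; (3) $\mathcal{R}(R)$ is relatively complemented; (4) $\mathcal{R}(R)$ is orthocomplemented.
   Context: A rack is a set $R$ with a binary operation $\triangleright$ such that $a\triangleright(b\triangleright c)=(a\triangleright b)\triangleright(a\triangleright c)$ for all $a,b,c\in R$, and for all $a,b\in R$ there is a unique $x\in R$ with $a\triangleright x=b$. A subrack is a subset $Q$ with $(Q,\triangleright)$ a rack (including $\emptyset$); $\ll S\gg$ is the intersection of all subracks containing $S$. $\mathcal{R}(R)$ is the lattice of subracks ordered by inclusion (meet = intersection, join = $\ll Q\cup Q'\gg$, bottom $\emptyset$, top $R$). For $a\in R$, $f_a(b)=a\triangleright b$; $\mathrm{Inn}(R)$ is the group generated by the $f_a$, and the orbits of $R$ are the orbits of $\mathrm{Inn}(R)$ on $R$. $R$ is a $G$-rack if $R$ is the only subrack of $R$ meeting every orbit of $R$. A lattice is a Boolean algebra if it is complemented and distributive; modular if $a\wedge(c\vee b)=(a\wedge c)\vee b$ whenever $b\le a$; relatively complemented if every interval $[x,y]$ is complemented. A lattice $L$ is orthocomplemented if it is complemented and there is a function $\phi:L\to L$ with $\phi^2=\mathrm{id}$, $\phi(x)$ a complement of $x$ for all $x$, and $\phi(y)\le\phi(x)$ whenever $x\le y$. -}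

module Defs where

open import Level using (0ℓ)
open import Data.Product using (Σ; Σ-syntax; ∃; ∃-syntax; _×_; _,_; proj₁)
open import Relation.Binary.PropositionalEquality using (_≡_)
open import Relation.Unary using (Pred; _∈_; _⊆_; _∩_; _∪_; ∅; U)

record Rack : Set₁ where
  infixr 20 _▷_
  field
    Carrier : Set
    _▷_     : Carrier → Carrier → Carrier
    selfdist : ∀ a b c → a ▷ (b ▷ c) ≡ (a ▷ b) ▷ (a ▷ c)
    solve    : ∀ a b → Σ[ x ∈ Carrier ] (a ▷ x ≡ b × (∀ y → a ▷ y ≡ b → y ≡ x))

  _◁_ : Carrier → Carrier → Carrier
  a ◁ b = proj₁ (solve a b)

module _ (R : Rack) where
  open Rack R

  Subset : Set₁
  Subset = Pred Carrier 0ℓ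

  -- Q is a subrack: (Q, ▷) is itself a rack (self-distributivity is
  -- inherited), i.e. Q is closed under ▷ and for a b ∈ Q there is a
  -- unique x ∈ Q with a ▷ x = b.  The empty set is a subrack.
  IsSubrack : Subset → Set
  IsSubrack Q =
    (∀ {a b} → a ∈ Q → b ∈ Q → (a ▷ b) ∈ Q) ×
    (∀ {a b} → a ∈ Q → b ∈ Q →
       Σ[ x ∈ Carrier ] (x ∈ Q × a ▷ x ≡ b ×
         (∀ y → y ∈ Q → a ▷ y ≡ b → y ≡ x)))

  -- ≪ S ≫ : the smallest subrack containing S, generated inductively
  -- (equal to the intersection of all subracks containing S).
  data ≪_≫ (S : Subset) : Subset where
    gen : ∀ {x} → x ∈ S → x ∈ ≪ S ≫
    op  : ∀ {a b} → a ∈ ≪ S ≫ → b ∈ ≪ S ≫ → (a ▷ b) ∈ ≪ S ≫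
    div : ∀ {a b} → a ∈ ≪ S ≫ → b ∈ ≪ S ≫ → (a ◁ b) ∈ ≪ S ≫

  _≈_ : Subset → Subset → Set
  P ≈ Q = P ⊆ Q × Q ⊆ P

  _∧_ : Subset → Subset → Subset
  P ∧ Q = P ∩ Q

  _∨_ : Subset → Subset → Subset
  P ∨ Q = ≪ P ∪ Q ≫

  Sub : Set₁
  Sub = Σ Subset IsSubrack

  -- Orbits of Inn(R): b is in the orbit of a iff b is obtained from a by
  -- applying finitely many generators f_c and their inverses f_c⁻¹.

  data Orb (a : Carrier) : Carrier → Set where
    here : Orb a a
    fwd  : ∀ {b} c → Orb a b → Orb a (c ▷ b)
    bwd  : ∀ {b} c → Orb a b → Orb a (c ◁ b)

  MeetsEveryOrbit : Subset → Set
  MeetsEveryOrbit Q = ∀ a → Σ[ b ∈ Carrier ] (b ∈ Q × Orb a b)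

  IsGRack : Set₁
  IsGRack = ∀ (Q : Subset) → IsSubrack Q → MeetsEveryOrbit Q → Q ≈ U

  IsComplementIn : Subset → Subset → Subset → Subset → Set
  IsComplementIn lo hi x y = (x ∧ y) ≈ lo × (x ∨ y) ≈ hi

  IsComplement : Subset → Subset → Set
  IsComplement = IsComplementIn ∅ U

  Complemented : Set₁
  Complemented = ∀ (x : Sub) → Σ[ y ∈ Sub ] IsComplement (proj₁ x) (proj₁ y)

  Distributive : Set₁
  Distributive = ∀ (a b c : Sub) →
    let A = proj₁ a ; B = proj₁ b ; C = proj₁ c in
    (A ∧ (B ∨ C)) ≈ ((A ∧ B) ∨ (A ∧ C))

  BooleanAlgebra : Set₁
  BooleanAlgebra = Complemented × Distributive

  Modular : Set₁
  Modular = ∀ (a b c : Sub) →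
    let A = proj₁ a ; B = proj₁ b ; C = proj₁ c in
    B ⊆ A → (A ∧ (C ∨ B)) ≈ ((A ∧ C) ∨ B)

  RelativelyComplemented : Set₁
  RelativelyComplemented = ∀ (x y : Sub) → proj₁ x ⊆ proj₁ y →
    ∀ (a : Sub) → proj₁ x ⊆ proj₁ a → proj₁ a ⊆ proj₁ y →
    Σ[ b ∈ Sub ] (proj₁ x ⊆ proj₁ b × proj₁ b ⊆ proj₁ y ×
                  IsComplementIn (proj₁ x) (proj₁ y) (proj₁ a) (proj₁ b))

  Orthocomplemented : Set₁
  Orthocomplemented = Complemented ×
    Σ[ φ ∈ (Sub → Sub) ]
      ((∀ x → proj₁ (φ (φ x)) ≈ proj₁ x) ×
       (∀ x → IsComplement (proj₁ x) (proj₁ (φ x))) ×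
       (∀ x y → proj₁ x ⊆ proj₁ y → proj₁ (φ y) ⊆ proj₁ (φ x)))

-- The pivot is the property UnionsOfOrbits: every subrack is invariant
-- under the generators f_c, f_c⁻¹ of Inn(R), i.e. is a union of orbits.
-- Such subsets are closed under complement, ∩ and ∪, and the join of two
-- of them is their union; so, classically, 𝓡(R) is then the Boolean algebra
-- of unions of orbits, which is relatively complemented and
-- orthocomplemented (by set complement).  Conversely, Boolean ⇒ modular is
-- pure lattice theory, and modularity, relative complements and an
-- orthocomplementation each force UnionsOfOrbits.  All three proofs compare
-- a subrack X with its orbit saturation Sat X and use the G-rack property
-- in the form "a set whose orbits cover R generates R" (absorbOrbits);
-- the orthocomplemented case also uses that preimages of subracks under
-- f_c and f_c⁻¹ are subracks meeting the same orbits.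
module Submission where

open import Defs
open import Level using (0ℓ; lift; lower)
open import Data.Product using (Σ-syntax; _×_; _,_; proj₁; proj₂)
open import Data.Sum using (inj₁; inj₂; [_,_]′)
open import Data.Empty using (⊥; ⊥-elim)
open import Function using (_∘_; id)
open import Function.Bundles using (_⇔_; mk⇔)
open import Relation.Nullary using (Dec; yes; no)
open import Relation.Nullary.Decidable using (map′)
open import Relation.Binary.PropositionalEquality
  using (_≡_; refl; sym; subst; cong; cong₂; module ≡-Reasoning)
open import Relation.Unary using (_∈_; _⊆_; _∩_; _∪_; U; ∁)
open import Axiom.ExcludedMiddle using (ExcludedMiddle)

decide : ExcludedMiddle (Level.suc 0ℓ) → (P : Set) → Dec P
decide em P = map′ lower lift em

module _ (R : Rack) where
  open Rack R

  ◁-unique : ∀ {a b x} → a ▷ x ≡ b → x ≡ a ◁ b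
  ◁-unique {a} {b} {x} = proj₂ (proj₂ (solve a b)) x

  ▷◁ : ∀ a b → a ▷ (a ◁ b) ≡ b
  ▷◁ a b = proj₁ (proj₂ (solve a b))

  ◁▷ : ∀ a b → a ◁ (a ▷ b) ≡ b
  ◁▷ a b = sym (◁-unique refl)

  -- f_c is an automorphism, so it also preserves ◁; dually for f_c⁻¹.
  ▷-distrib-◁ : ∀ c y z → c ▷ (y ◁ z) ≡ (c ▷ y) ◁ (c ▷ z)
  ▷-distrib-◁ c y z = ◁-unique (begin
    (c ▷ y) ▷ (c ▷ (y ◁ z)) ≡⟨ sym (selfdist c y (y ◁ z)) ⟩
    c ▷ (y ▷ (y ◁ z))       ≡⟨ cong (c ▷_) (▷◁ y z) ⟩
    c ▷ z                   ∎)
    where open ≡-Reasoning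

  ◁-distrib-▷ : ∀ c y z → c ◁ (y ▷ z) ≡ (c ◁ y) ▷ (c ◁ z)
  ◁-distrib-▷ c y z = sym (◁-unique (begin
    c ▷ ((c ◁ y) ▷ (c ◁ z))         ≡⟨ selfdist c (c ◁ y) (c ◁ z) ⟩
    (c ▷ (c ◁ y)) ▷ (c ▷ (c ◁ z))   ≡⟨ cong₂ _▷_ (▷◁ c y) (▷◁ c z) ⟩
    y ▷ z                           ∎))
    where open ≡-Reasoning

  ◁-distrib-◁ : ∀ c y z → c ◁ (y ◁ z) ≡ (c ◁ y) ◁ (c ◁ z)
  ◁-distrib-◁ c y z = sym (◁-unique (begin
    c ▷ ((c ◁ y) ◁ (c ◁ z))         ≡⟨ ▷-distrib-◁ c (c ◁ y) (c ◁ z) ⟩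
    (c ▷ (c ◁ y)) ◁ (c ▷ (c ◁ z))   ≡⟨ cong₂ _◁_ (▷◁ c y) (▷◁ c z) ⟩
    y ◁ z                           ∎))
    where open ≡-Reasoning

  Orb-trans : ∀ {a b c} → Orb R a b → Orb R b c → Orb R a c
  Orb-trans p here      = p
  Orb-trans p (fwd c q) = fwd c (Orb-trans p q)
  Orb-trans p (bwd c q) = bwd c (Orb-trans p q)

  Orb-sym : ∀ {a b} → Orb R a b → Orb R b a
  Orb-sym here      = here
  Orb-sym (fwd c q) = Orb-trans (subst (Orb R _) (◁▷ c _) (bwd c here)) (Orb-sym q)
  Orb-sym (bwd c q) = Orb-trans (subst (Orb R _) (▷◁ c _) (fwd c here)) (Orb-sym q)

  Closed : Subset R → Set
  Closed Q = (∀ {a b} → a ∈ Q → b ∈ Q → (a ▷ b) ∈ Q)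
           × (∀ {a b} → a ∈ Q → b ∈ Q → (a ◁ b) ∈ Q)

  closed⇒subrack : ∀ {Q} → Closed Q → IsSubrack R Q
  closed⇒subrack (▷-cl , ◁-cl) =
    ▷-cl , λ {a} {b} aQ bQ → a ◁ b , ◁-cl aQ bQ , ▷◁ a b , λ y _ → ◁-unique

  subrack⇒closed : ∀ {Q} → IsSubrack R Q → Closed Q
  subrack⇒closed {Q} (▷-cl , solvable) = ▷-cl , λ aQ bQ →
    let (x , xQ , ax≡b , _) = solvable aQ bQ in subst (_∈ Q) (◁-unique ax≡b) xQ

  subrack : (Q : Subset R) → Closed Q → Sub R
  subrack Q cl = Q , closed⇒subrack cl

  _⊓_ : Sub R → Sub R → Sub R
  (P , P-sub) ⊓ (Q , Q-sub) = subrack (P ∩ Q)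
    ( (λ (p , q) (p′ , q′) → proj₁ clP p p′ , proj₁ clQ q q′)
    , (λ (p , q) (p′ , q′) → proj₂ clP p p′ , proj₂ clQ q q′) )
    where
    clP : Closed P
    clP = subrack⇒closed P-sub
    clQ : Closed Q
    clQ = subrack⇒closed Q-sub

  Top : Sub R
  Top = subrack U ((λ _ _ → _) , (λ _ _ → _))

  ⟪_⟫ : Subset R → Subset R
  ⟪ S ⟫ = ≪_≫ R S

  ⟪⟫-closed : ∀ {S} → Closed ⟪ S ⟫
  ⟪⟫-closed = op , div

  ⟪⟫-least : ∀ {S Q} → Closed Q → S ⊆ Q → ⟪ S ⟫ ⊆ Q
  ⟪⟫-least cl S⊆Q (gen x)   = S⊆Q x
  ⟪⟫-least cl S⊆Q (op p q)  = proj₁ cl (⟪⟫-least cl S⊆Q p) (⟪⟫-least cl S⊆Q q)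
  ⟪⟫-least cl S⊆Q (div p q) = proj₂ cl (⟪⟫-least cl S⊆Q p) (⟪⟫-least cl S⊆Q q)

  ⟪⟫-mono : ∀ {S Q} → S ⊆ Q → ⟪ S ⟫ ⊆ ⟪ Q ⟫
  ⟪⟫-mono S⊆Q = ⟪⟫-least ⟪⟫-closed (gen ∘ S⊆Q)

  Invariant : Subset R → Set
  Invariant Q = ∀ c {b} → b ∈ Q → (c ▷ b) ∈ Q × (c ◁ b) ∈ Q

  invariant⇒closed : ∀ {Q} → Invariant Q → Closed Q
  invariant⇒closed inv = (λ {a} _ bQ → proj₁ (inv a bQ)) , (λ {a} _ bQ → proj₂ (inv a bQ))

  ∁-invariant : ∀ {Q} → Invariant Q → Invariant (∁ Q)
  ∁-invariant {Q} inv c {b} b∉Q =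
    (λ cb∈Q → b∉Q (subst (_∈ Q) (◁▷ c b) (proj₂ (inv c cb∈Q)))) ,
    (λ cb∈Q → b∉Q (subst (_∈ Q) (▷◁ c b) (proj₁ (inv c cb∈Q))))

  ∩-invariant : ∀ {P Q} → Invariant P → Invariant Q → Invariant (P ∩ Q)
  ∩-invariant iP iQ c (p , q) =
    (proj₁ (iP c p) , proj₁ (iQ c q)) , (proj₂ (iP c p) , proj₂ (iQ c q))

  ∪-invariant : ∀ {P Q} → Invariant P → Invariant Q → Invariant (P ∪ Q)
  ∪-invariant iP iQ c (inj₁ p) = inj₁ (proj₁ (iP c p)) , inj₁ (proj₂ (iP c p))
  ∪-invariant iP iQ c (inj₂ q) = inj₂ (proj₁ (iQ c q)) , inj₂ (proj₂ (iQ c q))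

  join-invariant : ∀ {P Q} → Invariant P → Invariant Q → ⟪ P ∪ Q ⟫ ⊆ P ∪ Q
  join-invariant iP iQ = ⟪⟫-least (invariant⇒closed (∪-invariant iP iQ)) id

  Sat : Subset R → Subset R
  Sat S y = Σ[ x ∈ Carrier ] (x ∈ S × Orb R x y)

  Sat-invariant : ∀ {S} → Invariant (Sat S)
  Sat-invariant c (x , xS , o) = (x , xS , fwd c o) , (x , xS , bwd c o)

  ⊆Sat : ∀ {S} → S ⊆ Sat S
  ⊆Sat s = _ , s , here

  Sat-least : ∀ {S Q} → Invariant Q → S ⊆ Q → Sat S ⊆ Q
  Sat-least {Q = Q} inv S⊆Q (x , xS , o) = along o
    where
    along : ∀ {y} → Orb R x y → y ∈ Q
    along here      = S⊆Q xS
    along (fwd c o) = proj₁ (inv c (along o))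
    along (bwd c o) = proj₂ (inv c (along o))

  Sat-mono : ∀ {S Q} → S ⊆ Q → Sat S ⊆ Sat Q
  Sat-mono S⊆Q = Sat-least Sat-invariant (⊆Sat ∘ S⊆Q)

  saturated⇒invariant : ∀ {Q} → Sat Q ⊆ Q → Invariant Q
  saturated⇒invariant Sat⊆Q c q =
    Sat⊆Q (proj₁ (Sat-invariant c (⊆Sat q))) , Sat⊆Q (proj₂ (Sat-invariant c (⊆Sat q)))

  Sat-∪ : ∀ {P Q} → Sat (P ∪ Q) ⊆ Sat P ∪ Sat Q
  Sat-∪ = Sat-least (∪-invariant Sat-invariant Sat-invariant)
                    [ inj₁ ∘ ⊆Sat , inj₂ ∘ ⊆Sat ]′

  ⟪⟫⊆Sat : ∀ {S} → ⟪ S ⟫ ⊆ Sat S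
  ⟪⟫⊆Sat = ⟪⟫-least (invariant⇒closed Sat-invariant) ⊆Sat

  SatSub : Subset R → Sub R
  SatSub S = subrack (Sat S) (invariant⇒closed Sat-invariant)

  OutsideSub : Subset R → Sub R
  OutsideSub S = subrack (∁ (Sat S)) (invariant⇒closed (∁-invariant Sat-invariant))

  -- A bijection g of R preserving ▷ and ◁ whose inverse h stays inside
  -- orbits; the generators f_c and f_c⁻¹ of Inn(R) are the instances used.
  record OrbitAutomorphism : Set where
    field
      g h     : Carrier → Carrier
      g-▷     : ∀ y z → g (y ▷ z) ≡ g y ▷ g z
      g-◁     : ∀ y z → g (y ◁ z) ≡ g y ◁ g z
      g∘h     : ∀ m → g (h m) ≡ m
      h-orbit : ∀ m → Orb R m (h m)

  f▷ : Carrier → OrbitAutomorphism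
  f▷ c = record { g = c ▷_ ; h = c ◁_ ; g-▷ = selfdist c ; g-◁ = ▷-distrib-◁ c
                ; g∘h = ▷◁ c ; h-orbit = λ m → bwd c here }

  f◁ : Carrier → OrbitAutomorphism
  f◁ c = record { g = c ◁_ ; h = c ▷_ ; g-▷ = ◁-distrib-▷ c ; g-◁ = ◁-distrib-◁ c
                ; g∘h = ◁▷ c ; h-orbit = λ m → fwd c here }

  preimage : OrbitAutomorphism → Sub R → Sub R
  preimage θ (Q , Q-sub) = subrack (λ y → g y ∈ Q)
    ( (λ {y} {z} p q → subst (_∈ Q) (sym (g-▷ y z)) (proj₁ cl p q))
    , (λ {y} {z} p q → subst (_∈ Q) (sym (g-◁ y z)) (proj₂ cl p q)) )
    where
    open OrbitAutomorphism θ
    cl : Closed Q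
    cl = subrack⇒closed Q-sub

  preimage-orbits : ∀ θ Q → Sat (proj₁ Q) ⊆ Sat (proj₁ (preimage θ Q))
  preimage-orbits θ Q (m , mQ , o) =
    h m , subst (_∈ proj₁ Q) (sym (g∘h m)) mQ , Orb-trans (Orb-sym (h-orbit m)) o
    where open OrbitAutomorphism θ

  UnionsOfOrbits : Set₁
  UnionsOfOrbits = ∀ (X : Sub R) → Invariant (proj₁ X)

  -- Boolean ⇒ modular holds in every lattice: with B ⊆ A distributivity
  -- gives A ∧ (C ∨ B) = (A ∧ C) ∨ (A ∧ B) = (A ∧ C) ∨ B.
  boolean⇒modular : BooleanAlgebra R → Modular R
  boolean⇒modular (_ , distrib) A B C B⊆A with distrib A C B
  ... | expand , collect =
    ⟪⟫-mono [ inj₁ , inj₂ ∘ proj₂ ]′ ∘ expand ,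
    collect ∘ ⟪⟫-mono [ inj₁ , (λ b → inj₂ (B⊆A b , b)) ]′

  module _ (em : ExcludedMiddle (Level.suc 0ℓ)) where

    excluded : (Q : Subset R) (x : Carrier) → x ∈ Q ∪ ∁ Q
    excluded Q x with decide em (x ∈ Q)
    ... | yes x∈Q = inj₁ x∈Q
    ... | no  x∉Q = inj₂ x∉Q

    ∁Sub : UnionsOfOrbits → Sub R → Sub R
    ∁Sub uo X = subrack (∁ (proj₁ X)) (invariant⇒closed (∁-invariant (uo X)))

    ∁Sub-complement : ∀ uo X → IsComplement R (proj₁ X) (proj₁ (∁Sub uo X))
    ∁Sub-complement uo X =
      ((λ (x , x∉X) → x∉X x) , λ ()) , ((λ _ → _) , λ {x} _ → gen (excluded (proj₁ X) x))

    invariant⇒boolean : UnionsOfOrbits → BooleanAlgebra R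
    invariant⇒boolean uo = (λ X → ∁Sub uo X , ∁Sub-complement uo X) , distrib
      where
      distrib : Distributive R
      distrib A B C =
        (λ (a , bc) → gen ([ inj₁ ∘ (a ,_) , inj₂ ∘ (a ,_) ]′ (join-invariant iB iC bc))) ,
        [ (λ (a , b) → a , gen (inj₁ b)) , (λ (a , c) → a , gen (inj₂ c)) ]′
          ∘ join-invariant (∩-invariant iA iB) (∩-invariant iA iC)
        where
        iA : Invariant (proj₁ A)
        iB : Invariant (proj₁ B)
        iC : Invariant (proj₁ C)
        iA = uo A ; iB = uo B ; iC = uo C

    invariant⇒relativelyComplemented : UnionsOfOrbits → RelativelyComplemented R
    invariant⇒relativelyComplemented uo X Y X⊆Y A X⊆A A⊆Y =
      subrack B (invariant⇒closed iB) , inj₂ , B⊆Y ,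
      (A∩B⊆X , λ x → X⊆A x , inj₂ x) , (A∨B⊆Y , Y⊆A∨B)
      where
      B : Subset R
      B = (proj₁ Y ∩ ∁ (proj₁ A)) ∪ proj₁ X
      iB : Invariant B
      iB = ∪-invariant (∩-invariant (uo Y) (∁-invariant (uo A))) (uo X)
      B⊆Y : B ⊆ proj₁ Y
      B⊆Y = [ proj₁ , X⊆Y ]′
      A∩B⊆X : (proj₁ A ∩ B) ⊆ proj₁ X
      A∩B⊆X (a , inj₁ (_ , a∉A)) = ⊥-elim (a∉A a)
      A∩B⊆X (a , inj₂ x)         = x
      A∨B⊆Y : ⟪ proj₁ A ∪ B ⟫ ⊆ proj₁ Y
      A∨B⊆Y = [ A⊆Y , B⊆Y ]′ ∘ join-invariant (uo A) iB
      Y⊆A∨B : proj₁ Y ⊆ ⟪ proj₁ A ∪ B ⟫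
      Y⊆A∨B {y} y∈Y =
        gen ([ inj₁ , (λ y∉A → inj₂ (inj₁ (y∈Y , y∉A))) ]′ (excluded (proj₁ A) y))

    invariant⇒orthocomplemented : UnionsOfOrbits → Orthocomplemented R
    invariant⇒orthocomplemented uo =
      proj₁ (invariant⇒boolean uo) , ∁Sub uo , involutive , ∁Sub-complement uo ,
      λ X Y X⊆Y y∉Y x → y∉Y (X⊆Y x)
      where
      involutive : ∀ X → _≈_ R (proj₁ (∁Sub uo (∁Sub uo X))) (proj₁ X)
      involutive X =
        (λ {x} ¬¬x → [ id , ⊥-elim ∘ ¬¬x ]′ (excluded (proj₁ X) x)) , λ x x∉X → x∉X x

  module _ (gr : IsGRack R) where

    saturating⇒generating : ∀ {S} → (∀ t → t ∈ Sat S) → U ⊆ ⟪ S ⟫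
    saturating⇒generating {S} cover =
      proj₂ (gr ⟪ S ⟫ (closed⇒subrack ⟪⟫-closed) λ t →
        let (x , xS , o) = cover t in x , gen xS , Orb-sym o)

    absorbOrbits : ∀ {P Q} → U ⊆ ⟪ Sat P ∪ Q ⟫ → U ⊆ ⟪ P ∪ Q ⟫
    absorbOrbits top = saturating⇒generating λ t →
      Sat-least Sat-invariant [ Sat-mono inj₁ , ⊆Sat ∘ inj₂ ]′ (⟪⟫⊆Sat (top {t} _))

    -- A relative complement B of Sat X in [X, R] contains X and, with Sat X,
    -- generates R; hence X ∪ B = B does, so B = R and Sat X = Sat X ∧ B = X.
    relativelyComplemented⇒invariant : RelativelyComplemented R → UnionsOfOrbits
    relativelyComplemented⇒invariant rc X
      with rc X Top (λ _ → _) (SatSub (proj₁ X)) ⊆Sat (λ _ → _)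
    ... | B , X⊆B , _ , (SatX∩B⊆X , _) , (_ , R⊆SatX∨B) =
      saturated⇒invariant λ a∈SatX → SatX∩B⊆X (a∈SatX , B-top _)
      where
      B-top : U ⊆ proj₁ B
      B-top = ⟪⟫-least (subrack⇒closed (proj₂ B)) [ X⊆B , id ]′ ∘ absorbOrbits R⊆SatX∨B

    -- Modularity with Sat X ⊇ X and the outside T of Sat X, where X and T
    -- generate R: Sat X = Sat X ∧ (T ∨ X) = (Sat X ∧ T) ∨ X = X.
    modular⇒invariant : ExcludedMiddle (Level.suc 0ℓ) → Modular R → UnionsOfOrbits
    modular⇒invariant em modular X = saturated⇒invariant λ a∈SatX →
      ⟪⟫-least (subrack⇒closed (proj₂ X)) [ (λ (s , s∉) → ⊥-elim (s∉ s)) , id ]′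
        (proj₁ (modular (SatSub (proj₁ X)) X (OutsideSub (proj₁ X)) ⊆Sat) (a∈SatX , spans _))
      where
      spans : U ⊆ ⟪ ∁ (Sat (proj₁ X)) ∪ proj₁ X ⟫
      spans = saturating⇒generating λ t →
        [ Sat-mono inj₂ , ⊆Sat ∘ inj₁ ]′ (excluded em (Sat (proj₁ X)) t)

    -- Given an orthocomplementation ᶜ, the least subrack M whose orbits
    -- include those of X is invariant, since its preimages under f_c, f_c⁻¹
    -- are again such subracks; so Sat X ⊆ Sat M = M ⊆ X.
    module Orthocomplementation
        (φ : Sub R → Sub R)
        (involutive : ∀ X → _≈_ R (proj₁ (φ (φ X))) (proj₁ X))
        (complement : ∀ X → IsComplement R (proj₁ X) (proj₁ (φ X)))
        (antitone : ∀ X Y → proj₁ X ⊆ proj₁ Y → proj₁ (φ Y) ⊆ proj₁ (φ X)) where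

      _ᶜ : Sub R → Subset R
      X ᶜ = proj₁ (φ X)

      galois : ∀ X Y → proj₁ X ⊆ Y ᶜ → proj₁ Y ⊆ X ᶜ
      galois X Y X⊆Yᶜ = antitone X (φ Y) X⊆Yᶜ ∘ proj₂ (involutive Y)

      Topᶜ-empty : ∀ {x} → x ∈ Top ᶜ → ⊥
      Topᶜ-empty x = proj₁ (proj₁ (complement Top)) (_ , x)

      -- Yᶜ avoids the orbits of Y: C = (Sat Y)ᶜ together with Y generates R,
      -- both lie in Wᶜ for W = Yᶜ ∩ Cᶜ, so W ⊆ Topᶜ = ∅; but Yᶜ ∩ Sat Y ⊆ W.
      ᶜ-avoids-orbits : ∀ Y {y} → y ∈ Y ᶜ → y ∈ Sat (proj₁ Y) → ⊥
      ᶜ-avoids-orbits Y y∈Yᶜ y∈SatY =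
        Topᶜ-empty (galois Top W (λ _ → generated⊆Wᶜ (spans _))
                      (y∈Yᶜ , proj₂ (involutive A) y∈SatY))
        where
        A C W : Sub R
        A = SatSub (proj₁ Y)
        C = φ A
        W = φ Y ⊓ φ C
        spans : U ⊆ ⟪ proj₁ Y ∪ proj₁ C ⟫
        spans = absorbOrbits (proj₂ (proj₂ (complement A)))
        generated⊆Wᶜ : ⟪ proj₁ Y ∪ proj₁ C ⟫ ⊆ W ᶜ
        generated⊆Wᶜ = ⟪⟫-least (subrack⇒closed (proj₂ (φ W)))
                                [ galois W Y proj₁ , galois W C proj₂ ]′

      module _ (X : Sub R) where
        T : Sub R
        T = OutsideSub (proj₁ X)

        M : Subset R
        M = T ᶜ

        -- M lies in every subrack Y whose orbits include those of X,
        -- because then Yᶜ ⊆ T.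
        M-least : ∀ Y → Sat (proj₁ X) ⊆ Sat (proj₁ Y) → M ⊆ proj₁ Y
        M-least Y orbits = proj₁ (involutive Y) ∘ antitone (φ Y) T
          (λ y∈Yᶜ y∈SatX → ᶜ-avoids-orbits Y y∈Yᶜ (orbits y∈SatX))

        -- T ∨ M = R and T misses the orbits of X, so M meets all of them.
        M-orbits : Sat (proj₁ X) ⊆ Sat M
        M-orbits a∈SatX with Sat-∪ (⟪⟫⊆Sat (proj₂ (proj₂ (complement T)) {_} _))
        ... | inj₁ viaT = ⊥-elim (Sat-least (∁-invariant Sat-invariant) id viaT a∈SatX)
        ... | inj₂ viaM = viaM

        M-invariant : Invariant M
        M-invariant c m = M-least (preimage (f▷ c) (φ T)) (orbits (f▷ c)) m ,
                          M-least (preimage (f◁ c) (φ T)) (orbits (f◁ c)) m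
          where
          orbits : ∀ θ → Sat (proj₁ X) ⊆ Sat (proj₁ (preimage θ (φ T)))
          orbits θ = preimage-orbits θ (φ T) ∘ M-orbits

        X-invariant : Invariant (proj₁ X)
        X-invariant = saturated⇒invariant (M-least X id ∘ Sat-least M-invariant id ∘ M-orbits)

    orthocomplemented⇒invariant : Orthocomplemented R → UnionsOfOrbits
    orthocomplemented⇒invariant (_ , φ , involutive , complement , antitone) =
      Orthocomplementation.X-invariant φ involutive complement antitone

theorem4p4 : ExcludedMiddle (Level.suc 0ℓ) → (R : Rack) → IsGRack R →
    (BooleanAlgebra R ⇔ Modular R) ×
    (BooleanAlgebra R ⇔ RelativelyComplemented R) ×
    (BooleanAlgebra R ⇔ Orthocomplemented R)
theorem4p4 em R gr =
    mk⇔ (boolean⇒modular R) (invariant⇒boolean R em ∘ modular⇒invariant R gr em)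
  , mk⇔ (invariant⇒relativelyComplemented R em ∘ boolean⇒invariant)
        (invariant⇒boolean R em ∘ relativelyComplemented⇒invariant R gr)
  , mk⇔ (invariant⇒orthocomplemented R em ∘ boolean⇒invariant)
        (invariant⇒boolean R em ∘ orthocomplemented⇒invariant R gr)
  where
  boolean⇒invariant : BooleanAlgebra R → UnionsOfOrbits R
  boolean⇒invariant = modular⇒invariant R gr em ∘ boolean⇒modular R
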